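{- Every tree $T$ with at least one edge admits an odd-edge edge-magic total coloring.
   Context: For a tree $T$ with $q\ge1$ edges, $[0,2q-1]=\{0,1,\dots,2q-1\}$ and $[1,2q-1]^o$ is the set of odd integers in $[1,2q-1]$. An odd-edge edge-magic total coloring of $T$ is a map $h:V(T)\cup E(T)\to[0,2q-1]$ (vertex colors need not be distinct) such that $\{h(e):e\in E(T)\}=[1,2q-1]^o$ and there is a positive integer $k$ with $h(u)+h(uv)+h(v)=k$ for every edge $uv\in E(T)$. -}

module Defs where

open import Data.Nat using (ℕ; suc; _+_; _*_; _<_)
open import Data.Fin using (Fin)
open import Data.Product using (_×_; _,_; proj₁; proj₂; ∃)
open import Data.Sum using (_⊎_)
open import Relation.Binary.PropositionalEquality using (_≡_; _≢_)

Edges : ℕ → Set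
Edges q = Fin q → Fin (suc q) × Fin (suc q)

data Reach {q : ℕ} (E : Edges q) : Fin (suc q) → Fin (suc q) → Set where
  here : ∀ {u} → Reach E u u
  step : ∀ {u v w} (i : Fin q) →
         ((proj₁ (E i) ≡ u × proj₂ (E i) ≡ v) ⊎ (proj₁ (E i) ≡ v × proj₂ (E i) ≡ u)) →
         Reach E v w → Reach E u w

-- A tree with q edges: a loopless connected graph with q+1 vertices and q edges.
IsTree : (q : ℕ) → Edges q → Set
IsTree q E = (∀ i → proj₁ (E i) ≢ proj₂ (E i)) × (∀ u v → Reach E u v)

Odd : ℕ → Set
Odd m = ∃ λ j → m ≡ 2 * j + 1

IsOEEMTC : (q : ℕ) → Edges q → (Fin (suc q) → ℕ) → (Fin q → ℕ) → Set
IsOEEMTC q E hv he =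
  (∀ v → hv v < 2 * q) ×
  (∀ i → he i < 2 * q) ×
  (∀ i → Odd (he i)) ×
  (∀ m → Odd m → m < 2 * q → ∃ λ i → he i ≡ m) ×
  (∃ λ k → (0 < k) × (∀ i → hv (proj₁ (E i)) + he i + hv (proj₂ (E i)) ≡ k))

{-# OPTIONS --safe #-}
-- Grow the tree edge by edge from a root, each new edge attaching a fresh
-- vertex to a visited one.  Labelling the root 0 and the fresh end of the
-- t-th edge by 2t minus the label of its old end makes the label sums along
-- the edges exactly 0, 2, …, 2q−2; as every vertex lies on an edge, all
-- labels are below 2q.  Colouring the t-th edge by 2q−1−2t then uses every
-- odd number in [1, 2q−1] once, with magic constant 2q−1.
module Submission where

open import Defs
open import Data.Nat using (ℕ; zero; suc; _≤_; _<_; _+_; _*_; _∸_; z≤n; s≤s)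
open import Data.Nat.Properties
open import Data.Fin using (Fin; toℕ; fromℕ<; punchOut) renaming (zero to fzero; suc to fsuc)
import Data.Fin.Properties as Fin
open import Data.Product using (_×_; ∃; _,_; proj₁; proj₂)
open import Data.Sum using (_⊎_; inj₁; inj₂)
open import Function.Definitions using (Injective)
open import Relation.Nullary using (¬_; yes; no; contradiction)
open import Relation.Unary using (Pred; Decidable)
open import Relation.Binary using (DecidableEquality)
open import Relation.Binary.PropositionalEquality
open import Algebra.Properties.CommutativeSemigroup +-commutativeSemigroup using (xy∙z≈xz∙y)

module _ {A B : Set} (_≟_ : DecidableEquality A) where

  update : (A → B) → A → B → A → B
  update f a b x with x ≟ a
  ... | yes _ = b
  ... | no _ = f x

  update-same : ∀ f a b → update f a b a ≡ b
  update-same f a b with a ≟ a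
  ... | yes _ = refl
  ... | no a≢a = contradiction refl a≢a

  update-other : ∀ f a b {x} → x ≢ a → update f a b x ≡ f x
  update-other f a b {x} x≢a with x ≟ a
  ... | yes x≡a = contradiction x≡a x≢a
  ... | no _ = refl

endo-injective⇒surjective : ∀ {n} {f : Fin n → Fin n} → Injective _≡_ _≡_ f →
                            ∀ y → ∃ λ x → f x ≡ y
endo-injective⇒surjective {suc n} {f} f-injective y with Fin.any? (λ x → f x Fin.≟ y)
... | yes hit = hit
... | no miss = contradiction (Fin.injective⇒≤ squeezed-injective) 1+n≰n
  where
  avoids : ∀ x → y ≢ f x
  avoids x y≡fx = miss (x , sym y≡fx)

  squeezed-injective : Injective _≡_ _≡_ (λ x → punchOut (avoids x))
  squeezed-injective eq = f-injective (Fin.punchOut-injective (avoids _) (avoids _) eq)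

Among : ∀ {m} → (ℕ → Fin m) → ℕ → Pred (Fin m) _
Among f n x = ∃ λ s → s < n × f s ≡ x

among? : ∀ {m} (f : ℕ → Fin m) n → Decidable (Among f n)
among? f n x = anyUpTo? (λ s → f s Fin.≟ x) n

¬all-among : ∀ {n m} → n < m → (f : ℕ → Fin m) → ¬ (∀ x → Among f n x)
¬all-among n<m f all with Fin.pigeonhole n<m (λ x → fromℕ< (proj₁ (proj₂ (all x))))
... | x , y , x<y , same-index = Fin.<⇒≢ x<y (begin
  x                        ≡⟨ sym (proj₂ (proj₂ (all x))) ⟩
  f (proj₁ (all x))        ≡⟨ cong f (trans (sym (Fin.toℕ-fromℕ< _))
                                 (trans (cong toℕ same-index) (Fin.toℕ-fromℕ< _))) ⟩
  f (proj₁ (all y))        ≡⟨ proj₂ (proj₂ (all y)) ⟩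
  y                        ∎)
  where open ≡-Reasoning

module Graph {q : ℕ} (E : Edges q) where

  Vertex : Set
  Vertex = Fin (suc q)

  Joins : Fin q → Vertex → Vertex → Set
  Joins i x y = (proj₁ (E i) ≡ x × proj₂ (E i) ≡ y) ⊎ (proj₁ (E i) ≡ y × proj₂ (E i) ≡ x)

  Endpoint : Fin q → Vertex → Set
  Endpoint i x = proj₁ (E i) ≡ x ⊎ proj₂ (E i) ≡ x

  edgeSum : (Vertex → ℕ) → Fin q → ℕ
  edgeSum f i = f (proj₁ (E i)) + f (proj₂ (E i))

  joins-endpointˡ : ∀ {i x y} → Joins i x y → Endpoint i x
  joins-endpointˡ (inj₁ (p , _)) = inj₁ p
  joins-endpointˡ (inj₂ (_ , p)) = inj₂ p

  joins-endpointʳ : ∀ {i x y} → Joins i x y → Endpoint i y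
  joins-endpointʳ (inj₁ (_ , p)) = inj₂ p
  joins-endpointʳ (inj₂ (p , _)) = inj₁ p

  endpoint-joins : ∀ {i x y z} → Joins i x y → Endpoint i z → z ≡ x ⊎ z ≡ y
  endpoint-joins (inj₁ (refl , _)) (inj₁ refl) = inj₁ refl
  endpoint-joins (inj₁ (_ , refl)) (inj₂ refl) = inj₂ refl
  endpoint-joins (inj₂ (refl , _)) (inj₁ refl) = inj₂ refl
  endpoint-joins (inj₂ (_ , refl)) (inj₂ refl) = inj₁ refl

  edgeSum-joins : ∀ f {i x y} → Joins i x y → edgeSum f i ≡ f x + f y
  edgeSum-joins f (inj₁ (refl , refl)) = refl
  edgeSum-joins f (inj₂ (refl , refl)) = +-comm (f _) (f _)

  edgeSum-cong : ∀ {f g i} → (∀ {x} → Endpoint i x → f x ≡ g x) → edgeSum f i ≡ edgeSum g i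
  edgeSum-cong f≗g = cong₂ _+_ (f≗g (inj₁ refl)) (f≗g (inj₂ refl))

  endpoint≤edgeSum : ∀ f {i x} → Endpoint i x → f x ≤ edgeSum f i
  endpoint≤edgeSum f {i} (inj₁ refl) = m≤m+n _ (f (proj₂ (E i)))
  endpoint≤edgeSum f {i} (inj₂ refl) = m≤n+m _ (f (proj₁ (E i)))

  data Crossing (P : Pred Vertex _) : Set where
    crossing : ∀ i {x y} → P x → ¬ P y → Joins i x y → Crossing P

  reach-crossing : ∀ {P u w} → Decidable P → Reach E u w → P u → ¬ P w → Crossing P
  reach-crossing P? here Pu ¬Pw = contradiction Pu ¬Pw
  reach-crossing P? (step {v = v} i joins r) Pu ¬Pw with P? v
  ... | yes Pv = reach-crossing P? r Pv ¬Pw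
  ... | no ¬Pv = crossing i Pu ¬Pv joins

  reach-endpoint : ∀ {u w} → Reach E u w → u ≢ w → ∃ λ i → Endpoint i u
  reach-endpoint here u≢u = contradiction refl u≢u
  reach-endpoint (step i joins _) _ = i , joins-endpointˡ joins

record EvenSumLabelling {q : ℕ} (E : Edges q) : Set where
  field
    label : Fin (suc q) → ℕ
    rank : Fin q → Fin q
    rank-surjective : ∀ t → ∃ λ i → rank i ≡ t
    edgeSum-label : ∀ i → Graph.edgeSum E label i ≡ 2 * toℕ (rank i)

-- At least one edge, so that the edge sequence has a placeholder value
-- before anything is attached.
module Growing {q : ℕ} (E : Edges (suc q)) where
  open Graph E

  record Growth (j : ℕ) : Set where
    field
      vertex : ℕ → Vertex
      edge : ℕ → Fin (suc q)
      label : Vertex → ℕ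
      edge-injective : ∀ {s t} → s < j → t < j → edge s ≡ edge t → s ≡ t
      endpoint-visited : ∀ {t x} → t < j → Endpoint (edge t) x → Among vertex (suc j) x
      label-visited : ∀ {x} → Among vertex (suc j) x → label x ≤ 2 * j
      label-sum : ∀ {t} → t < j → edgeSum label (edge t) ≡ 2 * t

  start : Growth 0
  start = record
    { vertex = λ _ → fzero
    ; edge = λ _ → fzero
    ; label = λ _ → 0
    ; edge-injective = λ ()
    ; endpoint-visited = λ ()
    ; label-visited = λ _ → z≤n
    ; label-sum = λ ()
    }

  extend : ∀ {j} (G : Growth j) → Crossing (Among (Growth.vertex G) (suc j)) → Growth (suc j)
  extend {j} G (crossing i {a} {b} a-visited b-fresh joins) = record
    { vertex = vertex′
    ; edge = edge′
    ; label = label′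
    ; edge-injective = edge′-injective
    ; endpoint-visited = endpoint-visited′
    ; label-visited = label-visited′
    ; label-sum = label-sum′
    }
    where
    open Growth G

    vertex′ : ℕ → Vertex
    vertex′ = update _≟_ vertex (suc j) b

    Visited Visited′ : Pred Vertex _
    Visited = Among vertex (suc j)
    Visited′ = Among vertex′ (suc (suc j))

    edge′ : ℕ → Fin (suc q)
    edge′ = update _≟_ edge j i

    label′ : Vertex → ℕ
    label′ = update Fin._≟_ label b (2 * j ∸ label a)

    visited-still : ∀ {x} → Visited x → Visited′ x
    visited-still (s , s<1+j , refl) =
      s , m<n⇒m<1+n s<1+j , update-other _≟_ vertex (suc j) b (<⇒≢ s<1+j)

    b-visited : Visited′ b
    b-visited = suc j , ≤-refl , update-same _≟_ vertex (suc j) b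

    visited′-cases : ∀ {x} → Visited′ x → Visited x ⊎ x ≡ b
    visited′-cases (s , s<2+j , refl) with m<1+n⇒m<n∨m≡n s<2+j
    ... | inj₁ s<1+j = inj₁ (s , s<1+j , sym (update-other _≟_ vertex (suc j) b (<⇒≢ s<1+j)))
    ... | inj₂ refl = inj₂ (update-same _≟_ vertex (suc j) b)

    label-old : ∀ {x} → Visited x → label′ x ≡ label x
    label-old x-visited = update-other Fin._≟_ label b _ λ { refl → b-fresh x-visited }

    label-b : label′ b ≡ 2 * j ∸ label a
    label-b = update-same Fin._≟_ label b _

    edge-old : ∀ {t} → t < j → edge′ t ≡ edge t
    edge-old t<j = update-other _≟_ edge j i (<⇒≢ t<j)

    edge-new : edge′ j ≡ i
    edge-new = update-same _≟_ edge j i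

    old≢i : ∀ {t} → t < j → edge t ≢ i
    old≢i t<j refl = b-fresh (endpoint-visited t<j (joins-endpointʳ joins))

    edge′-injective : ∀ {s t} → s < suc j → t < suc j → edge′ s ≡ edge′ t → s ≡ t
    edge′-injective s<1+j t<1+j eq with m<1+n⇒m<n∨m≡n s<1+j | m<1+n⇒m<n∨m≡n t<1+j
    ... | inj₁ s<j | inj₁ t<j = edge-injective s<j t<j (trans (sym (edge-old s<j)) (trans eq (edge-old t<j)))
    ... | inj₁ s<j | inj₂ refl = contradiction (trans (sym (edge-old s<j)) (trans eq edge-new)) (old≢i s<j)
    ... | inj₂ refl | inj₁ t<j = contradiction (trans (sym (edge-old t<j)) (trans (sym eq) edge-new)) (old≢i t<j)
    ... | inj₂ refl | inj₂ refl = refl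

    endpoint-visited′ : ∀ {t x} → t < suc j → Endpoint (edge′ t) x → Visited′ x
    endpoint-visited′ t<1+j end with m<1+n⇒m<n∨m≡n t<1+j
    ... | inj₁ t<j rewrite edge-old t<j = visited-still (endpoint-visited t<j end)
    ... | inj₂ refl rewrite edge-new with endpoint-joins joins end
    ...   | inj₁ refl = visited-still a-visited
    ...   | inj₂ refl = b-visited

    label-visited′ : ∀ {x} → Visited′ x → label′ x ≤ 2 * suc j
    label-visited′ x-visited with visited′-cases x-visited
    ... | inj₁ old rewrite label-old old = ≤-trans (label-visited old) (*-monoʳ-≤ 2 (n≤1+n j))
    ... | inj₂ refl rewrite label-b = ≤-trans (m∸n≤m (2 * j) (label a)) (*-monoʳ-≤ 2 (n≤1+n j))

    label-sum′ : ∀ {t} → t < suc j → edgeSum label′ (edge′ t) ≡ 2 * t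
    label-sum′ t<1+j with m<1+n⇒m<n∨m≡n t<1+j
    ... | inj₁ t<j rewrite edge-old t<j =
      trans (edgeSum-cong λ end → label-old (endpoint-visited t<j end)) (label-sum t<j)
    ... | inj₂ refl rewrite edge-new = begin
      edgeSum label′ i            ≡⟨ edgeSum-joins label′ joins ⟩
      label′ a + label′ b         ≡⟨ cong₂ _+_ (label-old a-visited) label-b ⟩
      label a + (2 * j ∸ label a) ≡⟨ m+[n∸m]≡n (label-visited a-visited) ⟩
      2 * j                       ∎
      where open ≡-Reasoning

  module _ (connected : ∀ u v → Reach E u v) where

    growth : ∀ j → j ≤ suc q → Growth j
    growth zero _ = start
    growth (suc j) j<1+q = extend G (reach-crossing (among? vertex (suc j))
      (connected (vertex 0) (proj₁ unvisited)) (0 , s≤s z≤n , refl) (proj₂ unvisited))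
      where
      G : Growth j
      G = growth j (<⇒≤ j<1+q)
      open Growth G

      unvisited : ∃ λ x → ¬ Among vertex (suc j) x
      unvisited = Fin.¬∀⟶∃¬ _ _ (among? vertex (suc j)) (¬all-among (s≤s j<1+q) vertex)

    evenSumLabelling : EvenSumLabelling E
    evenSumLabelling = record
      { label = label
      ; rank = rank
      ; rank-surjective = λ t → edgeAt t , edgeAt-injective (proj₂ (position (edgeAt t)))
      ; edgeSum-label = λ i → subst (λ e → edgeSum label e ≡ 2 * toℕ (rank i))
                                    (proj₂ (position i)) (label-sum (Fin.toℕ<n (rank i)))
      }
      where
      open Growth (growth (suc q) ≤-refl)

      edgeAt : Fin (suc q) → Fin (suc q)
      edgeAt t = edge (toℕ t)

      edgeAt-injective : Injective _≡_ _≡_ edgeAt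
      edgeAt-injective eq = Fin.toℕ-injective (edge-injective (Fin.toℕ<n _) (Fin.toℕ<n _) eq)

      position : ∀ i → ∃ λ t → edgeAt t ≡ i
      position = endo-injective⇒surjective edgeAt-injective

      rank : Fin (suc q) → Fin (suc q)
      rank i = proj₁ (position i)

    every-vertex-endpoint : ∀ x → ∃ λ i → Endpoint i x
    every-vertex-endpoint fzero = reach-endpoint (connected fzero (fsuc fzero)) λ ()
    every-vertex-endpoint (fsuc x) = reach-endpoint (connected (fsuc x) fzero) λ ()

odd-complement : ∀ {n t} → t ≤ n → (2 * n + 1) ∸ 2 * t ≡ 2 * (n ∸ t) + 1
odd-complement {n} {t} t≤n =
  trans (+-∸-comm 1 (*-monoʳ-≤ 2 t≤n)) (cong (_+ 1) (sym (*-distribˡ-∸ 2 n t)))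

2n+1<2[1+n] : ∀ n → 2 * n + 1 < 2 * suc n
2n+1<2[1+n] n rewrite *-suc 2 n | +-comm (2 * n) 1 = ≤-refl

oddEdgeColouring : ∀ {q} {E : Edges (suc q)} → (∀ x → ∃ λ i → Graph.Endpoint E i x) →
  EvenSumLabelling E → ∃ λ hv → ∃ λ he → IsOEEMTC (suc q) E hv he
oddEdgeColouring {q} {E} incident L =
  label , colour , label-bound , colour-bound , colour-odd , colour-surjective ,
  2 * q + 1 , m≤n+m 1 (2 * q) , magic
  where
  open Graph E
  open EvenSumLabelling L

  rank≤q : ∀ i → toℕ (rank i) ≤ q
  rank≤q i = ≤-pred (Fin.toℕ<n (rank i))

  2rank≤2q+1 : ∀ i → 2 * toℕ (rank i) ≤ 2 * q + 1
  2rank≤2q+1 i = ≤-trans (*-monoʳ-≤ 2 (rank≤q i)) (m≤m+n (2 * q) 1)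

  colour : Fin (suc q) → ℕ
  colour i = (2 * q + 1) ∸ 2 * toℕ (rank i)

  label-bound : ∀ x → label x < 2 * suc q
  label-bound x with incident x
  ... | i , end = begin-strict
    label x            ≤⟨ endpoint≤edgeSum label end ⟩
    edgeSum label i    ≡⟨ edgeSum-label i ⟩
    2 * toℕ (rank i)   ≤⟨ 2rank≤2q+1 i ⟩
    2 * q + 1          <⟨ 2n+1<2[1+n] q ⟩
    2 * suc q          ∎
    where open ≤-Reasoning

  colour-bound : ∀ i → colour i < 2 * suc q
  colour-bound i = ≤-<-trans (m∸n≤m (2 * q + 1) (2 * toℕ (rank i))) (2n+1<2[1+n] q)

  colour-odd : ∀ i → Odd (colour i)
  colour-odd i = q ∸ toℕ (rank i) , odd-complement (rank≤q i)

  colour-surjective : ∀ m → Odd m → m < 2 * suc q → ∃ λ i → colour i ≡ m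
  colour-surjective _ (a , refl) m<2+2q = i , (begin
    colour i                   ≡⟨ cong (λ r → (2 * q + 1) ∸ 2 * r) rank≡q∸a ⟩
    (2 * q + 1) ∸ 2 * (q ∸ a)  ≡⟨ odd-complement (m∸n≤m q a) ⟩
    2 * (q ∸ (q ∸ a)) + 1      ≡⟨ cong (λ r → 2 * r + 1) (m∸[m∸n]≡n a≤q) ⟩
    2 * a + 1                  ∎)
    where
    open ≡-Reasoning
    a≤q : a ≤ q
    a≤q = ≤-pred (*-cancelˡ-< 2 a (suc q) (≤-<-trans (m≤m+n (2 * a) 1) m<2+2q))
    i : Fin (suc q)
    i = proj₁ (rank-surjective (fromℕ< (s≤s (m∸n≤m q a))))
    rank≡q∸a : toℕ (rank i) ≡ q ∸ a
    rank≡q∸a = trans (cong toℕ (proj₂ (rank-surjective _))) (Fin.toℕ-fromℕ< _)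

  magic : ∀ i → label (proj₁ (E i)) + colour i + label (proj₂ (E i)) ≡ 2 * q + 1
  magic i = begin
    label (proj₁ (E i)) + colour i + label (proj₂ (E i)) ≡⟨ xy∙z≈xz∙y (label (proj₁ (E i))) (colour i) _ ⟩
    edgeSum label i + colour i                           ≡⟨ cong (_+ colour i) (edgeSum-label i) ⟩
    2 * toℕ (rank i) + colour i                          ≡⟨ m+[n∸m]≡n (2rank≤2q+1 i) ⟩
    2 * q + 1                                            ∎
    where open ≡-Reasoning

mainTheorem9 : (q : ℕ) → 1 ≤ q → (E : Edges q) → IsTree q E →
    ∃ λ (hv : Fin (suc q) → ℕ) → ∃ λ (he : Fin q → ℕ) → IsOEEMTC q E hv he
mainTheorem9 (suc q) _ E (_ , connected) =
  oddEdgeColouring (every-vertex-endpoint connected) (evenSumLabelling connected)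
  where open Growing E
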